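{- Let $h$ be a valuation of $Fm''$ in $\mathfrak M_{4m}$ and let a rule of $\mathbb T$ have premise $\eta$ and alternative conclusion sets $\Upsilon_1,\dots,\Upsilon_n$. If $h$ satisfies $\eta$, then $h$ satisfies $\Upsilon_i$ for some $1\le i\le n$.
   Context: $M_4=\{\mathbf 0,\mathbf n,\mathbf b,\mathbf 1\}$ with operations $\neg\mathbf 0=\mathbf 1$, $\neg\mathbf 1=\mathbf 0$, $\neg\mathbf n=\mathbf n$, $\neg\mathbf b=\mathbf b$ and $\succ$ given by: $\mathbf 0\succ y=\mathbf 1$; $\mathbf n\succ\mathbf 0=\mathbf n$, $\mathbf n\succ\mathbf n=\mathbf 1$, $\mathbf n\succ\mathbf b=\mathbf b$, $\mathbf n\succ\mathbf 1=\mathbf 1$; $\mathbf b\succ\mathbf 0=\mathbf b$, $\mathbf b\succ\mathbf n=\mathbf n$, $\mathbf b\succ\mathbf b=\mathbf 1$, $\mathbf b\succ\mathbf 1=\mathbf 1$; $\mathbf 1\succ y=y$ (this is the algebra $\mathfrak M_{4m}$ in the signature $\{\neg,\succ\}$). Formulas of $Fm''$ are built from propositional variables with $\neg$ and $\succ$; a valuation is a homomorphism $h:Fm''\to M_4$. Signed formulas are $T(\alpha)$, $F(\alpha)$; $h$ satisfies $T(\alpha)$ iff $h(\alpha)\in\{\mathbf 1,\mathbf b\}$, satisfies $F(\alpha)$ iff $h(\alpha)\in\{\mathbf 0,\mathbf n\}$, and satisfies a set of signed formulas iff it satisfies each member. The rules of $\mathbb T$ (premise $\Rightarrow$ conclusion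 sets separated by $|$): $T(\alpha\succ\beta)\Rightarrow \{T(\beta)\}\,|\,\{T(\neg\alpha),F(\beta),T(\neg\beta)\}\,|\,\{F(\alpha),F(\beta),F(\neg\beta)\}$; $F(\alpha\succ\beta)\Rightarrow\{T(\alpha),F(\beta),F(\neg\beta)\}\,|\,\{F(\neg\alpha),F(\beta),T(\neg\beta)\}$; $T(\neg(\alpha\succ\beta))\Rightarrow\{T(\alpha),F(\beta),T(\neg\beta)\}\,|\,\{F(\neg\alpha),T(\beta),T(\neg\beta)\}$; $F(\neg(\alpha\succ\beta))\Rightarrow\{F(\neg\beta)\}\,|\,\{T(\neg\alpha),T(\beta),T(\neg\beta)\}\,|\,\{F(\alpha),F(\beta),T(\neg\beta)\}$; $T(\neg\neg\alpha)\Rightarrow\{T(\alpha)\}$; $F(\neg\neg\alpha)\Rightarrow\{F(\alpha)\}$. -}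

module Defs where

open import Data.Nat using (ℕ)
open import Data.List using (List; []; _∷_)
open import Data.List.Relation.Unary.All using (All)
open import Data.List.Relation.Unary.Any using (Any)
open import Relation.Binary.PropositionalEquality using (_≡_)
open import Data.Product using (_×_)
open import Data.Sum using (_⊎_)

data M4 : Set where
  𝟎 𝐧 𝐛 𝟏 : M4

neg : M4 → M4
neg 𝟎 = 𝟏
neg 𝐧 = 𝐧
neg 𝐛 = 𝐛
neg 𝟏 = 𝟎

imp : M4 → M4 → M4
imp 𝟎 y = 𝟏
imp 𝐧 𝟎 = 𝐧
imp 𝐧 𝐧 = 𝟏
imp 𝐧 𝐛 = 𝐛
imp 𝐧 𝟏 = 𝟏
imp 𝐛 𝟎 = 𝐛
imp 𝐛 𝐧 = 𝐧
imp 𝐛 𝐛 = 𝟏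
imp 𝐛 𝟏 = 𝟏
imp 𝟏 y = y

data Fm : Set where
  var : ℕ → Fm
  ¬ₒ_ : Fm → Fm
  _≻_ : Fm → Fm → Fm

infixr 5 _≻_
infix 6 ¬ₒ_

record Valuation : Set where
  field
    h : Fm → M4
    h-neg : ∀ α → h (¬ₒ α) ≡ neg (h α)
    h-imp : ∀ α β → h (α ≻ β) ≡ imp (h α) (h β)
open Valuation public

data Signed : Set where
  T F : Fm → Signed

Designated : M4 → Set
Designated x = (x ≡ 𝟏) ⊎ (x ≡ 𝐛)

Undesignated : M4 → Set
Undesignated x = (x ≡ 𝟎) ⊎ (x ≡ 𝐧)

Sat : Valuation → Signed → Set
Sat v (T α) = Designated (h v α)
Sat v (F α) = Undesignated (h v α)

SatSet : Valuation → List Signed → Set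
SatSet v Γ = All (Sat v) Γ

-- The rules of 𝕋: premise ⇒ list of alternative conclusion sets
data Rule : Signed → List (List Signed) → Set where
  T≻ : ∀ α β → Rule (T (α ≻ β))
    ((T β ∷ []) ∷ (T (¬ₒ α) ∷ F β ∷ T (¬ₒ β) ∷ []) ∷ (F α ∷ F β ∷ F (¬ₒ β) ∷ []) ∷ [])
  F≻ : ∀ α β → Rule (F (α ≻ β))
    ((T α ∷ F β ∷ F (¬ₒ β) ∷ []) ∷ (F (¬ₒ α) ∷ F β ∷ T (¬ₒ β) ∷ []) ∷ [])
  T¬≻ : ∀ α β → Rule (T (¬ₒ (α ≻ β)))
    ((T α ∷ F β ∷ T (¬ₒ β) ∷ []) ∷ (F (¬ₒ α) ∷ T β ∷ T (¬ₒ β) ∷ []) ∷ [])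
  F¬≻ : ∀ α β → Rule (F (¬ₒ (α ≻ β)))
    ((F (¬ₒ β) ∷ []) ∷ (T (¬ₒ α) ∷ T β ∷ T (¬ₒ β) ∷ []) ∷ (F α ∷ F β ∷ T (¬ₒ β) ∷ []) ∷ [])
  T¬¬ : ∀ α → Rule (T (¬ₒ ¬ₒ α)) ((T α ∷ []) ∷ [])
  F¬¬ : ∀ α → Rule (F (¬ₒ ¬ₒ α)) ((F α ∷ []) ∷ [])

-- Every rule of 𝕋 is schematic in two formulas α, β, and the value under h of each formula
-- occurring in it is determined by h α and h β.  So it suffices to check the rules on the
-- schemas in the variables p₀, p₁ for all 16 assignments of values in M4 to p₀, p₁, which is a
-- finite computation; the instance with α, β is then the substitution p₀ ↦ α, p₁ ↦ β.
module Submission where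

open import Defs
open import Data.Nat using (ℕ; zero; suc)
open import Data.Product using (_,_)
open import Data.Sum using (inj₁; inj₂)
open import Data.List using (List; map)
open import Data.List.Relation.Unary.All as All using (All; all?)
open import Data.List.Relation.Unary.Any as Any using (Any; any?)
open import Data.List.Relation.Unary.All.Properties using () renaming (map⁺ to All-map⁺)
open import Data.List.Relation.Unary.Any.Properties using () renaming (map⁺ to Any-map⁺)
open import Function using (id)
open import Relation.Nullary using (Dec; yes; no)
open import Relation.Nullary.Decidable using (True; toWitness; map′; _×-dec_; _→-dec_)
open import Relation.Unary using (Decidable)
open import Relation.Binary.PropositionalEquality using (_≡_; refl; trans; sym; cong; cong₂; subst)

sub : (ℕ → Fm) → Fm → Fm
sub σ (var n) = σ n
sub σ (¬ₒ φ) = ¬ₒ sub σ φ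
sub σ (φ ≻ ψ) = sub σ φ ≻ sub σ ψ

subˢ : (ℕ → Fm) → Signed → Signed
subˢ σ (T φ) = T (sub σ φ)
subˢ σ (F φ) = F (sub σ φ)

⟦_⟧ : Fm → (ℕ → M4) → M4
⟦ var n ⟧ ρ = ρ n
⟦ ¬ₒ φ ⟧ ρ = neg (⟦ φ ⟧ ρ)
⟦ φ ≻ ψ ⟧ ρ = imp (⟦ φ ⟧ ρ) (⟦ ψ ⟧ ρ)

h-sub : ∀ v {σ ρ} → (∀ n → h v (σ n) ≡ ρ n) → ∀ φ → h v (sub σ φ) ≡ ⟦ φ ⟧ ρ
h-sub v hσ≡ρ (var n) = hσ≡ρ n
h-sub v {σ} hσ≡ρ (¬ₒ φ) = trans (h-neg v (sub σ φ)) (cong neg (h-sub v hσ≡ρ φ))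
h-sub v {σ} hσ≡ρ (φ ≻ ψ) =
  trans (h-imp v (sub σ φ) (sub σ ψ)) (cong₂ imp (h-sub v hσ≡ρ φ) (h-sub v hσ≡ρ ψ))

infix 4 _⊨_

_⊨_ : (ℕ → M4) → Signed → Set
ρ ⊨ T φ = Designated (⟦ φ ⟧ ρ)
ρ ⊨ F φ = Undesignated (⟦ φ ⟧ ρ)

Sat-sub : ∀ v {σ ρ} → (∀ n → h v (σ n) ≡ ρ n) → ∀ s → Sat v (subˢ σ s) ≡ (ρ ⊨ s)
Sat-sub v hσ≡ρ (T φ) = cong Designated (h-sub v hσ≡ρ φ)
Sat-sub v hσ≡ρ (F φ) = cong Undesignated (h-sub v hσ≡ρ φ)

[_,_] : {A : Set} → A → A → ℕ → A
[ a , b ] zero = a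
[ a , b ] (suc _) = b

Valid : (ℕ → M4) → Signed → List (List Signed) → Set
Valid ρ η Υs = ρ ⊨ η → Any (All (ρ ⊨_)) Υs

ValidInM4 : Signed → List (List Signed) → Set
ValidInM4 η Υs = ∀ a b → Valid [ a , b ] η Υs

designated? : Decidable Designated
designated? 𝟎 = no λ { (inj₁ ()) ; (inj₂ ()) }
designated? 𝐧 = no λ { (inj₁ ()) ; (inj₂ ()) }
designated? 𝐛 = yes (inj₂ refl)
designated? 𝟏 = yes (inj₁ refl)

undesignated? : Decidable Undesignated
undesignated? 𝟎 = yes (inj₁ refl)
undesignated? 𝐧 = yes (inj₂ refl)
undesignated? 𝐛 = no λ { (inj₁ ()) ; (inj₂ ()) }
undesignated? 𝟏 = no λ { (inj₁ ()) ; (inj₂ ()) }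

⊨? : ∀ ρ → Decidable (ρ ⊨_)
⊨? ρ (T φ) = designated? (⟦ φ ⟧ ρ)
⊨? ρ (F φ) = undesignated? (⟦ φ ⟧ ρ)

valid? : ∀ ρ η Υs → Dec (Valid ρ η Υs)
valid? ρ η Υs = ⊨? ρ η →-dec any? (all? (⊨? ρ)) Υs

∀-M4? : {P : M4 → Set} → Decidable P → Dec (∀ x → P x)
∀-M4? P? = map′ (λ { (p𝟎 , p𝐧 , p𝐛 , p𝟏) → λ { 𝟎 → p𝟎 ; 𝐧 → p𝐧 ; 𝐛 → p𝐛 ; 𝟏 → p𝟏 } })
                (λ p → p 𝟎 , p 𝐧 , p 𝐛 , p 𝟏)
                (P? 𝟎 ×-dec P? 𝐧 ×-dec P? 𝐛 ×-dec P? 𝟏)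

validInM4? : ∀ η Υs → Dec (ValidInM4 η Υs)
validInM4? η Υs = ∀-M4? λ a → ∀-M4? λ b → valid? [ a , b ] η Υs

p₀ p₁ : Fm
p₀ = var 0
p₁ = var 1

-- The rule argument only fixes the schema; its validity is found by running validInM4?.
instance-sound : ∀ v α β {η Υs} → Rule η Υs → {True (validInM4? η Υs)} →
  Sat v (subˢ [ α , β ] η) → Any (SatSet v) (map (map (subˢ [ α , β ])) Υs)
instance-sound v α β {η} {Υs} _ {valid} sat =
  Any-map⁺ (Any.map (λ Γ → All-map⁺ (All.map (λ {s} → subst id (sym (Sat-sub v agree s))) Γ))
                    valid-at-h)
  where
  agree : ∀ n → h v ([ α , β ] n) ≡ [ h v α , h v β ] n
  agree zero = refl
  agree (suc _) = refl

  valid-at-h : Any (All ([ h v α , h v β ] ⊨_)) Υs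
  valid-at-h = toWitness valid (h v α) (h v β) (subst id (Sat-sub v agree η) sat)

lemma5p3 : (v : Valuation) (η : Signed) (Υs : List (List Signed)) →
    Rule η Υs → Sat v η → Any (SatSet v) Υs
lemma5p3 v _ _ (T≻ α β) = instance-sound v α β (T≻ p₀ p₁)
lemma5p3 v _ _ (F≻ α β) = instance-sound v α β (F≻ p₀ p₁)
lemma5p3 v _ _ (T¬≻ α β) = instance-sound v α β (T¬≻ p₀ p₁)
lemma5p3 v _ _ (F¬≻ α β) = instance-sound v α β (F¬≻ p₀ p₁)
lemma5p3 v _ _ (T¬¬ α) = instance-sound v α α (T¬¬ p₀)
lemma5p3 v _ _ (F¬¬ α) = instance-sound v α α (F¬¬ p₀)
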